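{- Let $n\geq 3$ and let $\mathcal{F}\subseteq 2^{[n]}$ be a family of subsets of $[n]=\{1,\ldots,n\}$ containing no four distinct members $A,B,C,D\in\mathcal{F}$ with $A\cup B\subseteq C\cap D$, and suppose $\emptyset\notin\mathcal{F}$ and $[n]\notin\mathcal{F}$. Then $$\sum_{F\in\mathcal{F}}\binom{n}{|F|}^{ -1}\leq 2.$$ -}

module Defs where

open import Data.Nat using (ℕ; zero; suc)
open import Data.Nat.Combinatorics using (_C_)
open import Data.Integer using (+_)
open import Data.Rational using (ℚ; 0ℚ; _+_; _/_)
open import Data.List using (List; []; _∷_)
open import Data.Fin.Subset using (Subset; ∣_∣; _∪_; _∩_; _⊆_)
open import Data.List.Membership.Propositional using (_∈_)
open import Relation.Binary.PropositionalEquality using (_≢_)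
open import Relation.Nullary using (¬_)
open import Data.Product using (_×_)

-- reciprocal of a natural number as a rational (with 1/0 := 0; only used
-- on binomial coefficients C(n,k) with k ≤ n, which are nonzero)
recipℕ : ℕ → ℚ
recipℕ zero    = 0ℚ
recipℕ (suc m) = + 1 / suc m

lubell : (n : ℕ) → List (Subset n) → ℚ
lubell n []       = 0ℚ
lubell n (F ∷ 𝓕) = recipℕ (n C ∣ F ∣) + lubell n 𝓕

NoButterfly : {n : ℕ} → List (Subset n) → Set
NoButterfly 𝓕 = ∀ A B C D → A ∈ 𝓕 → B ∈ 𝓕 → C ∈ 𝓕 → D ∈ 𝓕 →
  A ≢ B → A ≢ C → A ≢ D → B ≢ C → B ≢ D → C ≢ D →
  ¬ ((A ∪ B) ⊆ (C ∩ D))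

{-# OPTIONS --safe #-}
-- Double counting over the n! maximal chains of [n]: a set F lies on ∣F∣!(n−∣F∣)! of them, so the
-- claim says that a chain meets 𝓕 at most twice on average. A chain can meet 𝓕 in three sets
-- a ⊂ X ⊂ b (four would contain a butterfly); to pay for this, call a chain a pivot of such a
-- nested triple of 𝓕 if it passes through X but avoids a and b. Every chain satisfies
--   #(members of 𝓕 on it) + #(triples it pivots) ≤ 2 + #(nested triples on it),
-- because a pivot of one triple meets 𝓕 only in X and pivots no other triple (butterfly-freeness
-- again). Summing over all chains, it remains to show that a nested triple with a ≠ ∅ and b ≠ [n]
-- has at least as many pivots as chains through all of a, X and b. By inclusion–exclusion this
-- reduces to #(chains through a, X) + #(chains through X, b) ≤ #(chains through X), and each term
-- on the left is at most half the right-hand side since C(∣X∣, ∣a∣) ≥ 2 and C(n−∣X∣, ∣b∣−∣X∣) ≥ 2.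
module Submission where

open import Defs

module _ where

  open import Data.Nat.Base using (ℕ; zero; suc; _+_; _*_; _∸_; _!; _≤_; _<_; _>_; z≤n; s≤s; pred)
  open import Data.Nat.Properties
  open import Data.Nat.Combinatorics using (_C_; nCk≡n!/k![n-k]!; k![n∸k]!∣n!; nCk+nC[k+1]≡[n+1]C[k+1])
  open import Data.Nat.Coprimality using (1-coprimeTo)
  open import Data.Nat.DivMod using (m/n*n≡m)
  open import Data.Nat.Tactic.RingSolver using (solve-∀)
  open import Algebra.Properties.CommutativeSemigroup +-commutativeSemigroup using (interchange)
  open import Algebra.Properties.Semiring.Sum +-*-semiring using (sum; sum-cong-≗; ∑-distrib-+; *-distribˡ-sum; *-distribʳ-sum)
  import Data.Integer.Base as ℤ
  import Data.Integer.Properties as ℤ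
  import Data.Rational.Base as ℚ
  import Data.Rational.Properties as ℚ
  import Data.Rational.Unnormalised.Base as ℚᵘ
  import Data.Rational.Unnormalised.Properties as ℚᵘ
  open import Data.Bool.Base using (Bool; true; false; if_then_else_)
  open import Data.Bool.Properties using () renaming (_≟_ to _≟ᴮ_)
  open import Data.Empty using (⊥; ⊥-elim)
  open import Data.Unit.Base using (⊤; tt)
  open import Data.Product using (∃; _×_; _,_)
  open import Data.Sum using (inj₁; inj₂)
  open import Data.Fin.Base using (Fin; zero; suc)
  open import Data.Vec.Base using ([]; _∷_; insertAt; removeAt; here; there)
  open import Data.Vec.Properties using (≡-dec; insertAt-lookup; insertAt-removeAt; removeAt-insertAt; []=⇒lookup; lookup⇒[]=)
  open import Data.Fin.Subset using (Subset; ∣_∣; _⊆_; _⊂_; _∪_; _∩_; inside; outside) renaming (_∈_ to _∈ₛ_; _∉_ to _∉ₛ_; ⊥ to ∅; ⊤ to full)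
  open import Data.Fin.Subset.Properties using (_⊂?_; drop-∷-⊆; out⊆; in⊆in; s⊆s; out⊂in; s⊂s; ⊆-min; ∣⊥∣≡0; ∣p∣≤n; ∣p∣≡n⇒p≡⊤; ⊂-trans; ⊂-irref; p⊂q⇒p⊆q; p⊂q⇒∣p∣<∣q∣; x∈p∪q⁻; x∈p∩q⁺) renaming (_∈?_ to _∈ₛ?_)
  open import Data.List.Base using (List; []; _∷_; map; filter; length; downFrom; cartesianProduct)
  open import Data.List.Membership.Propositional using (_∈_; _∉_)
  open import Data.List.Membership.Propositional.Properties using (∈-downFrom⁺; ∈-downFrom⁻; ∈-cartesianProduct⁺; ∈-cartesianProduct⁻)
  open import Data.List.Relation.Unary.Any using (here; there)
  open import Data.List.Relation.Unary.All as All using (All; []; _∷_)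
  import Data.List.Relation.Unary.All.Properties as All
  open import Data.List.Relation.Unary.AllPairs as AllPairs using (AllPairs; []; _∷_)
  import Data.List.Relation.Unary.AllPairs.Properties as AllPairs
  open import Data.List.Relation.Unary.Unique.Propositional using (Unique)
  import Data.List.Relation.Unary.Unique.Propositional.Properties as Unique
  open import Function.Base using (_∘_)
  open import Function.Bundles using (_⇔_; mk⇔)
  open import Relation.Binary.Definitions using (DecidableEquality; tri<; tri≈; tri>)
  open import Relation.Binary.PropositionalEquality using (_≡_; _≢_; refl; sym; trans; cong; cong₂; subst; subst₂; module ≡-Reasoning)
  open import Relation.Nullary using (Dec; yes; no; does; ¬_; ¬?; _×-dec_; contradiction)
  open import Relation.Nullary.Decidable using (does-⇔; decidable-stable)
  open import Relation.Unary using (Decidable)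

  𝟙 : {P : Set} → Dec P → ℕ
  𝟙 P? = if does P? then 1 else 0

  module _ {P : Set} where

    𝟙≤1 : (P? : Dec P) → 𝟙 P? ≤ 1
    𝟙≤1 (yes _) = s≤s z≤n
    𝟙≤1 (no _)  = z≤n

    𝟙-yes : (P? : Dec P) → P → 𝟙 P? ≡ 1
    𝟙-yes (yes _) _ = refl
    𝟙-yes (no ¬p) p = contradiction p ¬p

    𝟙-no : (P? : Dec P) → ¬ P → 𝟙 P? ≡ 0
    𝟙-no (yes p) ¬p = contradiction p ¬p
    𝟙-no (no _)  _  = refl

    𝟙-pos : (P? : Dec P) → 0 < 𝟙 P? → P
    𝟙-pos (yes p) _ = p

  𝟙-cong : ∀ {P Q : Set} (P? : Dec P) (Q? : Dec Q) → P ⇔ Q → 𝟙 P? ≡ 𝟙 Q?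
  𝟙-cong P? Q? P⇔Q = cong (λ b → if b then 1 else 0) (does-⇔ P⇔Q P? Q?)

  ≯0⇒≡0 : ∀ {m} → ¬ 0 < m → m ≡ 0
  ≯0⇒≡0 m≯0 = n≤0⇒n≡0 (≮⇒≥ m≯0)

  ΣL : {A : Set} → List A → (A → ℕ) → ℕ
  ΣL []       f = 0
  ΣL (x ∷ xs) f = f x + ΣL xs f

  module _ {A : Set} where

    ΣL-cong : ∀ xs {f g : A → ℕ} → (∀ x → f x ≡ g x) → ΣL xs f ≡ ΣL xs g
    ΣL-cong []       f≗g = refl
    ΣL-cong (x ∷ xs) f≗g = cong₂ _+_ (f≗g x) (ΣL-cong xs f≗g)

    ΣL-mono : ∀ xs {f g : A → ℕ} → (∀ {x} → x ∈ xs → f x ≤ g x) → ΣL xs f ≤ ΣL xs g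
    ΣL-mono []       f≤g = z≤n
    ΣL-mono (x ∷ xs) f≤g = +-mono-≤ (f≤g (here refl)) (ΣL-mono xs (f≤g ∘ there))

    ΣL-+ : ∀ xs (f g : A → ℕ) → ΣL xs (λ x → f x + g x) ≡ ΣL xs f + ΣL xs g
    ΣL-+ []       f g = refl
    ΣL-+ (x ∷ xs) f g = trans (cong (f x + g x +_) (ΣL-+ xs f g)) (interchange (f x) (g x) _ _)

    ΣL-zero : ∀ xs {f : A → ℕ} → (∀ {x} → x ∈ xs → f x ≡ 0) → ΣL xs f ≡ 0
    ΣL-zero []       _   = refl
    ΣL-zero (x ∷ xs) f≡0 = cong₂ _+_ (f≡0 (here refl)) (ΣL-zero xs (f≡0 ∘ there))

    ∈⇒≤ΣL : ∀ {xs x} (f : A → ℕ) → x ∈ xs → f x ≤ ΣL xs f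
    ∈⇒≤ΣL {y ∷ xs} f (here refl) = m≤m+n (f y) _
    ∈⇒≤ΣL {y ∷ xs} f (there x∈) = ≤-trans (∈⇒≤ΣL f x∈) (m≤n+m _ (f y))

    ΣL-pos : ∀ xs {f : A → ℕ} → 0 < ΣL xs f → ∃ λ x → x ∈ xs × 0 < f x
    ΣL-pos (x ∷ xs) {f} 0<Σ with f x in fx≡
    ... | suc _ = x , here refl , subst (0 <_) (sym fx≡) (s≤s z≤n)
    ... | zero  = let y , y∈ , 0<fy = ΣL-pos xs 0<Σ in y , there y∈ , 0<fy

    ΣL-≤1 : ∀ {xs} {f : A → ℕ} {c} → Unique xs → (∀ x → f x ≤ 1) →
            (∀ {x} → x ∈ xs → 0 < f x → x ≡ c) → ΣL xs f ≤ 1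
    ΣL-≤1 {[]}     _             _   _    = z≤n
    ΣL-≤1 {x ∷ xs} {f} (x∉xs ∷ u) f≤1 only with 0 <? f x
    ... | no  f≯0 = begin
      f x + ΣL xs f ≡⟨ cong (_+ ΣL xs f) (≯0⇒≡0 f≯0) ⟩
      ΣL xs f       ≤⟨ ΣL-≤1 u f≤1 (only ∘ there) ⟩
      1             ∎
      where open ≤-Reasoning
    ... | yes 0<f = begin
      f x + ΣL xs f ≡⟨ cong (f x +_) rest≡0 ⟩
      f x + 0       ≡⟨ +-identityʳ (f x) ⟩
      f x           ≤⟨ f≤1 x ⟩
      1             ∎
      where
      open ≤-Reasoning
      rest≡0 : ΣL xs f ≡ 0
      rest≡0 = ΣL-zero xs λ {y} y∈ → ≯0⇒≡0 λ 0<fy →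
        All.lookup x∉xs y∈ (trans (only (here refl) 0<f) (sym (only (there y∈) 0<fy)))

    ΣL-𝟙 : ∀ {P : A → Set} (P? : Decidable P) xs → ΣL xs (λ x → 𝟙 (P? x)) ≡ length (filter P? xs)
    ΣL-𝟙 P? []       = refl
    ΣL-𝟙 P? (x ∷ xs) with does (P? x)
    ... | true  = cong suc (ΣL-𝟙 P? xs)
    ... | false = ΣL-𝟙 P? xs

  ΣL-swap : ∀ {A B : Set} (xs : List A) (ys : List B) (f : A → B → ℕ) →
            ΣL xs (λ x → ΣL ys (f x)) ≡ ΣL ys (λ y → ΣL xs (λ x → f x y))
  ΣL-swap []       ys f = sym (ΣL-zero ys (λ _ → refl))
  ΣL-swap (x ∷ xs) ys f = trans (cong (ΣL ys (f x) +_) (ΣL-swap xs ys f)) (sym (ΣL-+ ys (f x) _))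

  module _ {A : Set} (_≟_ : DecidableEquality A) where

    open import Data.List.Membership.DecPropositional _≟_ using (_∈?_)

    ΣL-𝟙≟≤𝟙∈ : ∀ {xs} → Unique xs → ∀ y → ΣL xs (λ x → 𝟙 (y ≟ x)) ≤ 𝟙 (y ∈? xs)
    ΣL-𝟙≟≤𝟙∈ {xs} xs! y with y ∈? xs
    ... | yes _  = ΣL-≤1 xs! (λ x → 𝟙≤1 (y ≟ x)) (λ _ 0<𝟙 → sym (𝟙-pos (y ≟ _) 0<𝟙))
    ... | no  y∉ = ≤-reflexive (ΣL-zero xs λ x∈ → 𝟙-no (y ≟ _) λ y≡x → y∉ (subst (_∈ xs) (sym y≡x) x∈))

  _≟ₛ_ : ∀ {n} → DecidableEquality (Subset n)
  _≟ₛ_ = ≡-dec _≟ᴮ_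

  ∣insertAt∣ : ∀ {n} (p : Subset n) x → ∣ insertAt p x inside ∣ ≡ suc ∣ p ∣
  ∣insertAt∣ p             zero    = refl
  ∣insertAt∣ (inside ∷ p)  (suc x) = cong suc (∣insertAt∣ p x)
  ∣insertAt∣ (outside ∷ p) (suc x) = ∣insertAt∣ p x

  module _ {n : ℕ} where

    x∈insertAt : ∀ (p : Subset n) x → x ∈ₛ insertAt p x inside
    x∈insertAt p x = lookup⇒[]= x _ (insertAt-lookup p x inside)

    insertAt-removeAt-∈ : ∀ {T : Subset (suc n)} {x} → x ∈ₛ T → insertAt (removeAt T x) x inside ≡ T
    insertAt-removeAt-∈ {T} {x} x∈T =
      trans (cong (insertAt (removeAt T x) x) (sym ([]=⇒lookup x∈T))) (insertAt-removeAt T x)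

    ∣removeAt∣ : ∀ {T : Subset (suc n)} {x} → x ∈ₛ T → ∣ T ∣ ≡ suc ∣ removeAt T x ∣
    ∣removeAt∣ {T} {x} x∈T = trans (cong ∣_∣ (sym (insertAt-removeAt-∈ x∈T))) (∣insertAt∣ (removeAt T x) x)

  ∷-⊆ : ∀ {m k} {s t : Bool} {p q : Subset m} {p′ q′ : Subset k} → s ∷ p ⊆ t ∷ q → p′ ⊆ q′ → s ∷ p′ ⊆ t ∷ q′
  ∷-⊆ {s = outside}               _ p′⊆q′ = out⊆ p′⊆q′
  ∷-⊆ {s = inside} {t = inside}   _ p′⊆q′ = in⊆in p′⊆q′
  ∷-⊆ {s = inside} {t = outside} h _ with h here
  ... | ()

  insertAt-mono-⊆ : ∀ {n} {p q : Subset n} x s → p ⊆ q → insertAt p x s ⊆ insertAt q x s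
  insertAt-mono-⊆ zero    s p⊆q = s⊆s p⊆q
  insertAt-mono-⊆ {p = _ ∷ _} {_ ∷ _} (suc x) s p⊆q = ∷-⊆ p⊆q (insertAt-mono-⊆ x s (drop-∷-⊆ p⊆q))

  removeAt-mono-⊆ : ∀ {n} {p q : Subset (suc n)} x → p ⊆ q → removeAt p x ⊆ removeAt q x
  removeAt-mono-⊆ {p = _ ∷ _} {_ ∷ _} zero p⊆q = drop-∷-⊆ p⊆q
  removeAt-mono-⊆ {suc n} {_ ∷ _ ∷ _} {_ ∷ _ ∷ _} (suc x) p⊆q = ∷-⊆ p⊆q (removeAt-mono-⊆ x (drop-∷-⊆ p⊆q))

  removeAt-ascending : ∀ {n} (x : Fin (suc n)) {Ts} → AllPairs _⊆_ Ts → AllPairs _⊆_ (map (λ T → removeAt T x) Ts)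
  removeAt-ascending x asc = AllPairs.map⁺ (AllPairs.map (removeAt-mono-⊆ x) asc)

  ⊆∧∣<∣⇒⊂ : ∀ {n} {p q : Subset n} → p ⊆ q → ∣ p ∣ < ∣ q ∣ → p ⊂ q
  ⊆∧∣<∣⇒⊂ {p = outside ∷ p} {inside  ∷ q} p⊆q _        = out⊂in (drop-∷-⊆ p⊆q)
  ⊆∧∣<∣⇒⊂ {p = outside ∷ p} {outside ∷ q} p⊆q ∣p∣<∣q∣ = s⊂s (⊆∧∣<∣⇒⊂ (drop-∷-⊆ p⊆q) ∣p∣<∣q∣)
  ⊆∧∣<∣⇒⊂ {p = inside  ∷ p} {inside  ∷ q} p⊆q (s≤s ∣p∣<∣q∣) = s⊂s (⊆∧∣<∣⇒⊂ (drop-∷-⊆ p⊆q) ∣p∣<∣q∣)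
  ⊆∧∣<∣⇒⊂ {p = inside  ∷ p} {outside ∷ q} p⊆q _ with p⊆q here
  ... | ()

  ∣p∣≡0⇒p≡∅ : ∀ {n} (p : Subset n) → ∣ p ∣ ≡ 0 → p ≡ ∅
  ∣p∣≡0⇒p≡∅ []            _     = refl
  ∣p∣≡0⇒p≡∅ (outside ∷ p) ∣p∣≡0 = cong (outside ∷_) (∣p∣≡0⇒p≡∅ p ∣p∣≡0)

  ∪⊆∩ : ∀ {n} {A B C D : Subset n} → A ⊆ C → A ⊆ D → B ⊆ C → B ⊆ D → A ∪ B ⊆ C ∩ D
  ∪⊆∩ {A = A} {B} A⊆C A⊆D B⊆C B⊆D x∈A∪B with x∈p∪q⁻ A B x∈A∪B
  ... | inj₁ x∈A = x∈p∩q⁺ (A⊆C x∈A , A⊆D x∈A)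
  ... | inj₂ x∈B = x∈p∩q⁺ (B⊆C x∈B , B⊆D x∈B)

  ⊂⇒≢ : ∀ {n} {p q : Subset n} → p ⊂ q → p ≢ q
  ⊂⇒≢ p⊂q p≡q = ⊂-irref p≡q p⊂q

  nCk*k![n∸k]!≡n! : ∀ {n k} → k ≤ n → (n C k) * (k ! * (n ∸ k) !) ≡ n !
  nCk*k![n∸k]!≡n! {n} {k} k≤n = trans (cong (_* (k ! * (n ∸ k) !)) (nCk≡n!/k![n-k]! k≤n)) (m/n*n≡m (k![n∸k]!∣n! k≤n))
    where instance _ = k !* (n ∸ k) !≢0

  nCk>0 : ∀ {n k} → k ≤ n → 0 < n C k
  nCk>0 {n} {k} k≤n with n C k | nCk*k![n∸k]!≡n! k≤n
  ... | zero  | 0≡n! = contradiction (subst (1 ≤_) (sym 0≡n!) (1≤n! n)) λ ()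
  ... | suc _ | _    = s≤s z≤n

  nCk≥2 : ∀ {n k} → 0 < k → k < n → 2 ≤ n C k
  nCk≥2 {suc n} {suc k} _ (s≤s k<n) =
    subst (2 ≤_) (nCk+nC[k+1]≡[n+1]C[k+1] n k) (+-mono-≤ (nCk>0 (<⇒≤ k<n)) (nCk>0 k<n))

  2*k![n∸k]!≤n! : ∀ {n k} → 0 < k → k < n → 2 * (k ! * (n ∸ k) !) ≤ n !
  2*k![n∸k]!≤n! {n} {k} 0<k k<n = begin
    2 * (k ! * (n ∸ k) !)        ≤⟨ *-monoˡ-≤ _ (nCk≥2 0<k k<n) ⟩
    (n C k) * (k ! * (n ∸ k) !)  ≡⟨ nCk*k![n∸k]!≡n! (<⇒≤ k<n) ⟩
    n !                          ∎
    where open ≤-Reasoning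

  [n∸k]∸[m∸k]≡n∸m : ∀ {k m} n → k ≤ m → (n ∸ k) ∸ (m ∸ k) ≡ n ∸ m
  [n∸k]∸[m∸k]≡n∸m {k} {m} n k≤m = trans (∸-+-assoc n k (m ∸ k)) (cong (n ∸_) (m+[n∸m]≡n k≤m))

  j![k∸j]![n∸k]!+k![m∸k]![n∸m]!≤k![n∸k]! : ∀ {j k m n} → 0 < j → j < k → k < m → m < n →
    j ! * ((k ∸ j) ! * (n ∸ k) !) + k ! * ((m ∸ k) ! * (n ∸ m) !) ≤ k ! * (n ∸ k) !
  j![k∸j]![n∸k]!+k![m∸k]![n∸m]!≤k![n∸k]! {j} {k} {m} {n} 0<j j<k k<m m<n = *-cancelˡ-≤ 2 (begin
    2 * (j ! * ((k ∸ j) ! * F) + k ! * (G * (n ∸ m) !))     ≡⟨ regroup (j !) ((k ∸ j) !) F (k !) G ((n ∸ m) !) ⟩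
    2 * (j ! * (k ∸ j) !) * F + k ! * (2 * (G * (n ∸ m) !)) ≤⟨ +-mono-≤ (*-monoˡ-≤ F (2*k![n∸k]!≤n! 0<j j<k)) (*-monoʳ-≤ (k !) 2*[m∸k]![n∸m]!≤F) ⟩
    k ! * F + k ! * F                                       ≡⟨ double (k !) F ⟩
    2 * (k ! * F)                                           ∎)
    where
    open ≤-Reasoning
    F = (n ∸ k) !
    G = (m ∸ k) !
    regroup : ∀ a b c d e f → 2 * (a * (b * c) + d * (e * f)) ≡ 2 * (a * b) * c + d * (2 * (e * f))
    regroup = solve-∀
    double : ∀ a b → a * b + a * b ≡ 2 * (a * b)
    double = solve-∀
    2*[m∸k]![n∸m]!≤F : 2 * (G * (n ∸ m) !) ≤ F
    2*[m∸k]![n∸m]!≤F = subst (λ t → 2 * (G * t !) ≤ F) ([n∸k]∸[m∸k]≡n∸m n (<⇒≤ k<m))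
              (2*k![n∸k]!≤n! (m<n⇒0<n∸m k<m) (∸-monoˡ-< m<n (<⇒≤ k<m)))

  -- Maximal chains

  sum-mono : ∀ {m} {f g : Fin m → ℕ} → (∀ i → f i ≤ g i) → sum f ≤ sum g
  sum-mono {zero}  _   = z≤n
  sum-mono {suc m} f≤g = +-mono-≤ (f≤g zero) (sum-mono (f≤g ∘ suc))

  sum-const : ∀ m c → sum {m} (λ _ → c) ≡ m * c
  sum-const zero    c = refl
  sum-const (suc m) c = cong (c +_) (sum-const m c)

  sum-𝟙∈ : ∀ {m} (T : Subset m) → sum (λ x → 𝟙 (x ∈ₛ? T)) ≡ ∣ T ∣
  sum-𝟙∈ []            = refl
  sum-𝟙∈ (inside  ∷ T) = cong suc (sum-𝟙∈ T)
  sum-𝟙∈ (outside ∷ T) = sum-𝟙∈ T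

  -- A maximal chain ∅ = S₀ ⊂ S₁ ⊂ ⋯ ⊂ Sₙ = [n] is encoded by the point x with S₁ = {x}, followed by a
  -- maximal chain of the remaining n − 1 points, renumbered by deleting position x; level ch i is Sᵢ.
  Chain : ℕ → Set
  Chain zero    = ⊤
  Chain (suc n) = Fin (suc n) × Chain n

  ΣC : ∀ n → (Chain n → ℕ) → ℕ
  ΣC zero    f = f tt
  ΣC (suc n) f = sum λ x → ΣC n (λ c → f (x , c))

  ΣC-cong : ∀ n {f g : Chain n → ℕ} → (∀ c → f c ≡ g c) → ΣC n f ≡ ΣC n g
  ΣC-cong zero    f≗g = f≗g tt
  ΣC-cong (suc n) f≗g = sum-cong-≗ λ x → ΣC-cong n (λ c → f≗g (x , c))

  ΣC-mono : ∀ n {f g : Chain n → ℕ} → (∀ c → f c ≤ g c) → ΣC n f ≤ ΣC n g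
  ΣC-mono zero    f≤g = f≤g tt
  ΣC-mono (suc n) f≤g = sum-mono λ x → ΣC-mono n (λ c → f≤g (x , c))

  ΣC-+ : ∀ n (f g : Chain n → ℕ) → ΣC n (λ c → f c + g c) ≡ ΣC n f + ΣC n g
  ΣC-+ zero    f g = refl
  ΣC-+ (suc n) f g = trans (sum-cong-≗ λ x → ΣC-+ n (λ c → f (x , c)) (λ c → g (x , c)))
                           (∑-distrib-+ (λ x → ΣC n (λ c → f (x , c))) (λ x → ΣC n (λ c → g (x , c))))

  ΣC-*ˡ : ∀ n k (f : Chain n → ℕ) → ΣC n (λ c → k * f c) ≡ k * ΣC n f
  ΣC-*ˡ zero    k f = refl
  ΣC-*ˡ (suc n) k f = trans (sum-cong-≗ λ x → ΣC-*ˡ n k (λ c → f (x , c)))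
                            (sym (*-distribˡ-sum k (λ x → ΣC n (λ c → f (x , c)))))

  ΣC-1 : ∀ n → ΣC n (λ _ → 1) ≡ n !
  ΣC-1 zero    = refl
  ΣC-1 (suc n) = trans (sum-cong-≗ {suc n} {λ _ → ΣC n (λ _ → 1)} (λ _ → ΣC-1 n)) (sum-const (suc n) (n !))

  ΣC-ΣL : ∀ {A : Set} n (xs : List A) (f : Chain n → A → ℕ) →
          ΣC n (λ c → ΣL xs (f c)) ≡ ΣL xs (λ x → ΣC n (λ c → f c x))
  ΣC-ΣL n []       f = ΣC-*ˡ n 0 (λ _ → 0)
  ΣC-ΣL n (x ∷ xs) f = trans (ΣC-+ n _ _) (cong (ΣC n (λ c → f c x) +_) (ΣC-ΣL n xs f))

  level : ∀ {n} → Chain n → ℕ → Subset n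
  level {zero}  _       _       = []
  level {suc n} (x , c) zero    = ∅
  level {suc n} (x , c) (suc i) = insertAt (level c i) x inside

  level-zero : ∀ {n} (ch : Chain n) → level ch 0 ≡ ∅
  level-zero {zero}  _ = refl
  level-zero {suc n} _ = refl

  ∣level∣ : ∀ {n} (ch : Chain n) {i} → i ≤ n → ∣ level ch i ∣ ≡ i
  ∣level∣ {zero}  _       z≤n      = refl
  ∣level∣ {suc n} _       {zero} _ = ∣⊥∣≡0 (suc n)
  ∣level∣ {suc n} (x , c) {suc i} (s≤s i≤n) = trans (∣insertAt∣ (level c i) x) (cong suc (∣level∣ c i≤n))

  level-mono : ∀ {n} (ch : Chain n) {i j} → i ≤ j → level ch i ⊆ level ch j
  level-mono {zero}  _       _         ()
  level-mono {suc n} _       {zero} _  = ⊆-min _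
  level-mono {suc n} (x , c) (s≤s i≤j) = insertAt-mono-⊆ x inside (level-mono c i≤j)

  OnChain : ∀ {n} → Chain n → Subset n → Set
  OnChain ch T = level ch ∣ T ∣ ≡ T

  on? : ∀ {n} (ch : Chain n) T → Dec (OnChain ch T)
  on? ch T = level ch ∣ T ∣ ≟ₛ T

  on : ∀ {n} → Chain n → Subset n → ℕ
  on ch T = 𝟙 (on? ch T)

  through : ∀ {n} → Chain n → List (Subset n) → ℕ
  through ch []       = 1
  through ch (T ∷ Ts) = on ch T * through ch Ts

  module _ {n} (x : Fin (suc n)) (c : Chain n) where

    on-removeAt : ∀ {T} → x ∈ₛ T → on (x , c) T ≡ on c (removeAt T x)
    on-removeAt {T} x∈T = 𝟙-cong (on? (x , c) T) (on? c R) (mk⇔ to from)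
      where
      R = removeAt T x
      level≡ : level (x , c) ∣ T ∣ ≡ insertAt (level c ∣ R ∣) x inside
      level≡ = cong (level (x , c)) (∣removeAt∣ x∈T)
      to : OnChain (x , c) T → OnChain c R
      to T-on = trans (sym (removeAt-insertAt (level c ∣ R ∣) x inside))
                      (cong (λ S → removeAt S x) (trans (sym level≡) T-on))
      from : OnChain c R → OnChain (x , c) T
      from R-on = trans level≡ (trans (cong (λ S → insertAt S x inside) R-on) (insertAt-removeAt-∈ x∈T))

    x∈level : ∀ {i} → i ≢ 0 → x ∈ₛ level (x , c) i
    x∈level {zero}  0≢0 = contradiction refl 0≢0
    x∈level {suc i} _   = x∈insertAt (level c i) x

    on-∉ : ∀ {T} → x ∉ₛ T → ∣ T ∣ ≢ 0 → on (x , c) T ≡ 0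
    on-∉ {T} x∉T ∣T∣≢0 = 𝟙-no (on? (x , c) T) λ T-on → x∉T (subst (x ∈ₛ_) T-on (x∈level ∣T∣≢0))

    through-removeAt : ∀ {Ts} → All (x ∈ₛ_) Ts → through (x , c) Ts ≡ through c (map (λ T → removeAt T x) Ts)
    through-removeAt []           = refl
    through-removeAt (x∈T ∷ x∈Ts) = cong₂ _*_ (on-removeAt x∈T) (through-removeAt x∈Ts)

  gapFactorials : ∀ {n} → ℕ → List (Subset n) → ℕ
  gapFactorials {n} p []       = (n ∸ p) !
  gapFactorials     p (T ∷ Ts) = (∣ T ∣ ∸ p) ! * gapFactorials ∣ T ∣ Ts

  gapFactorials-removeAt : ∀ {n} (x : Fin (suc n)) p {Ts} → All (x ∈ₛ_) Ts →
    gapFactorials p (map (λ T → removeAt T x) Ts) ≡ gapFactorials (suc p) Ts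
  gapFactorials-removeAt x p []                     = refl
  gapFactorials-removeAt x p {T ∷ _} (x∈T ∷ x∈Ts) rewrite ∣removeAt∣ x∈T =
    cong ((∣ removeAt T x ∣ ∸ p) ! *_) (gapFactorials-removeAt x ∣ removeAt T x ∣ x∈Ts)

  n*[n∸1]!≡n! : ∀ {n} → n ≢ 0 → n * (n ∸ 1) ! ≡ n !
  n*[n∸1]!≡n! {zero}  0≢0 = contradiction refl 0≢0
  n*[n∸1]!≡n! {suc n} _   = refl

  ChainCount : ∀ n → List (Subset n) → Set
  ChainCount n Ts = ΣC n (λ ch → through ch Ts) ≡ gapFactorials 0 Ts

  chain-count-∅∷ : ∀ {n} (T : Subset n) Ts → ∣ T ∣ ≡ 0 → ChainCount n Ts → ChainCount n (T ∷ Ts)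
  chain-count-∅∷ {n} T Ts ∣T∣≡0 count = begin
    ΣC n (λ ch → on ch T * through ch Ts) ≡⟨ ΣC-cong n (λ ch → cong (_* through ch Ts) (on-∅ ch)) ⟩
    ΣC n (λ ch → 1 * through ch Ts)       ≡⟨ ΣC-*ˡ n 1 (λ ch → through ch Ts) ⟩
    1 * ΣC n (λ ch → through ch Ts)       ≡⟨ cong (1 *_) count ⟩
    1 * gapFactorials 0 Ts                ≡⟨ cong (λ t → t ! * gapFactorials t Ts) ∣T∣≡0 ⟨
    gapFactorials 0 (T ∷ Ts)              ∎
    where
    open ≡-Reasoning
    on-∅ : ∀ ch → on ch T ≡ 1
    on-∅ ch = 𝟙-yes (on? ch T) (trans (cong (level ch) ∣T∣≡0) (trans (level-zero ch) (sym (∣p∣≡0⇒p≡∅ T ∣T∣≡0))))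

  -- A chain (x , c) passes through T ∷ Ts only if x ∈ T, and then exactly when c passes through
  -- these sets with x deleted; so each of the ∣ T ∣ admissible x contributes the same count.
  chain-count-∷ : ∀ {n} {T : Subset (suc n)} {Ts} → All (T ⊆_) Ts → ChainCount (suc n) Ts →
    (∀ x → ChainCount n (map (λ U → removeAt U x) (T ∷ Ts))) → ChainCount (suc n) (T ∷ Ts)
  chain-count-∷ {T = T} {Ts} _ count₀ _ with ∣ T ∣ ≟ 0
  ... | yes ∣T∣≡0 = chain-count-∅∷ T Ts ∣T∣≡0 count₀
  chain-count-∷ {n} {T} {Ts} T⊆Ts _ count₁ | no ∣T∣≢0 = begin
    sum (λ x → ΣC n (λ c → through (x , c) (T ∷ Ts))) ≡⟨ sum-cong-≗ count-from ⟩
    sum (λ x → 𝟙 (x ∈ₛ? T) * K)                         ≡⟨ *-distribʳ-sum K (λ x → 𝟙 (x ∈ₛ? T)) ⟨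
    sum (λ x → 𝟙 (x ∈ₛ? T)) * K                         ≡⟨ cong (_* K) (sum-𝟙∈ T) ⟩
    ∣ T ∣ * ((∣ T ∣ ∸ 1) ! * G)                        ≡⟨ *-assoc ∣ T ∣ _ G ⟨
    ∣ T ∣ * (∣ T ∣ ∸ 1) ! * G                          ≡⟨ cong (_* G) (n*[n∸1]!≡n! ∣T∣≢0) ⟩
    ∣ T ∣ ! * G                                        ∎
    where
    open ≡-Reasoning
    G = gapFactorials ∣ T ∣ Ts
    K = gapFactorials 1 (T ∷ Ts)
    count-from : ∀ x → ΣC n (λ c → through (x , c) (T ∷ Ts)) ≡ 𝟙 (x ∈ₛ? T) * K
    count-from x with x ∈ₛ? T
    ... | no  x∉T = trans (ΣC-cong n λ c → cong (_* through (x , c) Ts) (on-∉ x c x∉T ∣T∣≢0))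
                          (ΣC-*ˡ n 0 (λ c → through (x , c) Ts))
    ... | yes x∈T = begin
      ΣC n (λ c → through (x , c) (T ∷ Ts))                       ≡⟨ ΣC-cong n (λ c → through-removeAt x c x∈Ts) ⟩
      ΣC n (λ c → through c (map (λ U → removeAt U x) (T ∷ Ts))) ≡⟨ count₁ x ⟩
      gapFactorials 0 (map (λ U → removeAt U x) (T ∷ Ts))         ≡⟨ gapFactorials-removeAt x 0 x∈Ts ⟩
      K                                                           ≡⟨ +-identityʳ K ⟨
      1 * K                                                       ∎
      where
      x∈Ts : All (x ∈ₛ_) (T ∷ Ts)
      x∈Ts = x∈T ∷ All.map (λ T⊆U → T⊆U x∈T) T⊆Ts

  chain-count : ∀ n (Ts : List (Subset n)) → AllPairs _⊆_ Ts → ChainCount n Ts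
  chain-count n       []        []           = ΣC-1 n
  chain-count zero    ([] ∷ Ts) (_ ∷ asc)    = chain-count-∅∷ [] Ts refl (chain-count zero Ts asc)
  chain-count (suc n) (T ∷ Ts)  (T⊆Ts ∷ asc) =
    chain-count-∷ T⊆Ts (chain-count (suc n) Ts asc) λ x → chain-count n _ (removeAt-ascending x (T⊆Ts ∷ asc))

  ΣC-on : ∀ {n} (F : Subset n) → ΣC n (λ ch → on ch F) ≡ ∣ F ∣ ! * (n ∸ ∣ F ∣) !
  ΣC-on {n} F = trans (ΣC-cong n λ ch → sym (*-identityʳ (on ch F))) (chain-count n (F ∷ []) ([] ∷ []))

  module _ {n} (ch : Chain n) where

    level-onChain : ∀ {i} → i ≤ n → OnChain ch (level ch i)
    level-onChain i≤n = cong (level ch) (∣level∣ ch i≤n)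

    level-⊂ : ∀ {i j} → i < j → j ≤ n → level ch i ⊂ level ch j
    level-⊂ i<j j≤n = ⊆∧∣<∣⇒⊂ (level-mono ch (<⇒≤ i<j))
      (subst₂ _<_ (sym (∣level∣ ch (≤-trans (<⇒≤ i<j) j≤n))) (sym (∣level∣ ch j≤n)) i<j)

    onChain-⊂ : ∀ {F G} → OnChain ch F → OnChain ch G → ∣ F ∣ < ∣ G ∣ → F ⊂ G
    onChain-⊂ {G = G} F-on G-on ∣F∣<∣G∣ = subst₂ _⊂_ F-on G-on (level-⊂ ∣F∣<∣G∣ (∣p∣≤n G))

    onChain-≡ : ∀ {F G} → OnChain ch F → OnChain ch G → ∣ F ∣ ≡ ∣ G ∣ → F ≡ G
    onChain-≡ F-on G-on ∣F∣≡∣G∣ = trans (sym F-on) (trans (cong (level ch) ∣F∣≡∣G∣) G-on)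

    through-onChain : ∀ {Ts} → All (OnChain ch) Ts → through ch Ts ≡ 1
    through-onChain []             = refl
    through-onChain (T-on ∷ Ts-on) = cong₂ _*_ (𝟙-yes (on? ch _) T-on) (through-onChain Ts-on)

  -- Chains through a nested triple

  -- [Q ∧ ¬P ∧ ¬R] = [Q] − [P ∧ Q] − [Q ∧ R] + [P ∧ Q ∧ R], with the products written as through computes them.
  𝟙-inclusion-exclusion : ∀ {P Q R : Set} (P? : Dec P) (Q? : Dec Q) (R? : Dec R) →
    𝟙 (Q? ×-dec (¬? P? ×-dec ¬? R?)) + (𝟙 P? * (𝟙 Q? * 1) + 𝟙 Q? * (𝟙 R? * 1)) ≡
    𝟙 Q? * 1 + 𝟙 P? * (𝟙 Q? * (𝟙 R? * 1))
  𝟙-inclusion-exclusion (yes _) (yes _) (yes _) = refl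
  𝟙-inclusion-exclusion (yes _) (yes _) (no  _) = refl
  𝟙-inclusion-exclusion (yes _) (no  _) (yes _) = refl
  𝟙-inclusion-exclusion (yes _) (no  _) (no  _) = refl
  𝟙-inclusion-exclusion (no  _) (yes _) (yes _) = refl
  𝟙-inclusion-exclusion (no  _) (yes _) (no  _) = refl
  𝟙-inclusion-exclusion (no  _) (no  _) (yes _) = refl
  𝟙-inclusion-exclusion (no  _) (no  _) (no  _) = refl

  Pivot : ∀ {n} → Chain n → Subset n → Subset n → Subset n → Set
  Pivot ch a X b = OnChain ch X × ¬ OnChain ch a × ¬ OnChain ch b

  pivot? : ∀ {n} (ch : Chain n) a X b → Dec (Pivot ch a X b)
  pivot? ch a X b = on? ch X ×-dec (¬? (on? ch a) ×-dec ¬? (on? ch b))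

  ΣC-through≤ΣC-pivot : ∀ {n} {a X b : Subset n} → a ⊂ X → X ⊂ b → 0 < ∣ a ∣ → ∣ b ∣ < n →
    ΣC n (λ ch → through ch (a ∷ X ∷ b ∷ [])) ≤ ΣC n (λ ch → 𝟙 (pivot? ch a X b))
  ΣC-through≤ΣC-pivot {n} {a} {X} {b} a⊂X X⊂b 0<∣a∣ ∣b∣<n = +-cancelˡ-≤ N₂ N₃ O (begin
    N₂ + N₃ ≤⟨ +-monoˡ-≤ N₃ N₂≤N₁ ⟩
    N₁ + N₃ ≡⟨ inclusion-exclusion ⟨
    O + N₂  ≡⟨ +-comm O N₂ ⟩
    N₂ + O  ∎)
    where
    open ≤-Reasoning
    a⊆X = p⊂q⇒p⊆q a⊂X
    X⊆b = p⊂q⇒p⊆q X⊂b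
    O  = ΣC n (λ ch → 𝟙 (pivot? ch a X b))
    N₁ = ΣC n (λ ch → through ch (X ∷ []))
    N₂ = ΣC n (λ ch → through ch (a ∷ X ∷ []) + through ch (X ∷ b ∷ []))
    N₃ = ΣC n (λ ch → through ch (a ∷ X ∷ b ∷ []))
    inclusion-exclusion : O + N₂ ≡ N₁ + N₃
    inclusion-exclusion = trans (sym (ΣC-+ n _ _))
      (trans (ΣC-cong n λ ch → 𝟙-inclusion-exclusion (on? ch a) (on? ch X) (on? ch b)) (ΣC-+ n _ _))
    N₂≤N₁ : N₂ ≤ N₁
    N₂≤N₁ = begin
      N₂                                                           ≡⟨ ΣC-+ n _ _ ⟩
      ΣC n (λ ch → through ch (a ∷ X ∷ [])) + ΣC n (λ ch → through ch (X ∷ b ∷ []))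
        ≡⟨ cong₂ _+_ (chain-count n _ ((a⊆X ∷ []) ∷ [] ∷ [])) (chain-count n _ ((X⊆b ∷ []) ∷ [] ∷ [])) ⟩
      gapFactorials 0 (a ∷ X ∷ []) + gapFactorials 0 (X ∷ b ∷ [])
        ≤⟨ j![k∸j]![n∸k]!+k![m∸k]![n∸m]!≤k![n∸k]! 0<∣a∣ (p⊂q⇒∣p∣<∣q∣ a⊂X) (p⊂q⇒∣p∣<∣q∣ X⊂b) ∣b∣<n ⟩
      gapFactorials 0 (X ∷ [])                                     ≡⟨ chain-count n _ ([] ∷ []) ⟨
      N₁                                                           ∎

  -- The double count for a butterfly-free family

  butterfly : ∀ {n} {𝓕 : List (Subset n)} → NoButterfly 𝓕 → ∀ {A B C D} → A ∈ 𝓕 → B ∈ 𝓕 → C ∈ 𝓕 → D ∈ 𝓕 →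
    A ≢ B → C ≢ D → A ⊂ C → A ⊂ D → B ⊂ C → B ⊂ D → ⊥
  butterfly noButterfly A∈ B∈ C∈ D∈ A≢B C≢D A⊂C A⊂D B⊂C B⊂D =
    noButterfly _ _ _ _ A∈ B∈ C∈ D∈ A≢B (⊂⇒≢ A⊂C) (⊂⇒≢ A⊂D) (⊂⇒≢ B⊂C) (⊂⇒≢ B⊂D) C≢D
      (∪⊆∩ (p⊂q⇒p⊆q A⊂C) (p⊂q⇒p⊆q A⊂D) (p⊂q⇒p⊆q B⊂C) (p⊂q⇒p⊆q B⊂D))

  downFrom-decreasing : ∀ n → AllPairs _>_ (downFrom n)
  downFrom-decreasing zero    = []
  downFrom-decreasing (suc n) = All.tabulate ∈-downFrom⁻ ∷ downFrom-decreasing n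

  module Counting {n} {𝓕 : List (Subset n)} (𝓕! : Unique 𝓕) (noButterfly : NoButterfly 𝓕) (∅∉𝓕 : ∅ ∉ 𝓕) (full∉𝓕 : full ∉ 𝓕) where

    open import Data.List.Membership.DecPropositional (_≟ₛ_ {n}) using (_∈?_)
    open ≤-Reasoning

    0<∣F∣ : ∀ {F} → F ∈ 𝓕 → 0 < ∣ F ∣
    0<∣F∣ {F} F∈ = n≢0⇒n>0 λ ∣F∣≡0 → ∅∉𝓕 (subst (_∈ 𝓕) (∣p∣≡0⇒p≡∅ F ∣F∣≡0) F∈)

    ∣F∣<n : ∀ {F} → F ∈ 𝓕 → ∣ F ∣ < n
    ∣F∣<n {F} F∈ = ≤∧≢⇒< (∣p∣≤n F) λ ∣F∣≡n → full∉𝓕 (subst (_∈ 𝓕) (∣p∣≡n⇒p≡⊤ ∣F∣≡n) F∈)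

    Triple : Set
    Triple = Subset n × Subset n × Subset n

    𝓕³ : List Triple
    𝓕³ = cartesianProduct 𝓕 (cartesianProduct 𝓕 𝓕)

    ∈𝓕³⁺ : ∀ {a X b} → a ∈ 𝓕 → X ∈ 𝓕 → b ∈ 𝓕 → (a , X , b) ∈ 𝓕³
    ∈𝓕³⁺ a∈ X∈ b∈ = ∈-cartesianProduct⁺ a∈ (∈-cartesianProduct⁺ X∈ b∈)

    ∈𝓕³⁻ : ∀ {a X b} → (a , X , b) ∈ 𝓕³ → a ∈ 𝓕 × X ∈ 𝓕 × b ∈ 𝓕
    ∈𝓕³⁻ t∈ with a∈ , Xb∈ ← ∈-cartesianProduct⁻ 𝓕 _ t∈ = a∈ , ∈-cartesianProduct⁻ 𝓕 𝓕 Xb∈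

    𝓕³! : Unique 𝓕³
    𝓕³! = Unique.cartesianProduct⁺ 𝓕! (Unique.cartesianProduct⁺ 𝓕! 𝓕!)

    Nested : Triple → Set
    Nested (a , X , b) = a ⊂ X × X ⊂ b

    nested? : ∀ t → Dec (Nested t)
    nested? (a , X , b) = (a ⊂? X) ×-dec (X ⊂? b)

    tripleOn pivotAt : Chain n → Triple → ℕ
    tripleOn    ch t@(a , X , b) = 𝟙 (nested? t) * through ch (a ∷ X ∷ b ∷ [])
    pivotAt ch t@(a , X , b) = 𝟙 (nested? t ×-dec pivot? ch a X b)

    membersOn triplesOn pivotsAt : Chain n → ℕ
    membersOn ch = ΣL 𝓕 (on ch)
    triplesOn ch = ΣL 𝓕³ (tripleOn ch)
    pivotsAt ch = ΣL 𝓕³ (pivotAt ch)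

    ΣC-triplesOn≤ΣC-pivotsAt : ΣC n triplesOn ≤ ΣC n pivotsAt
    ΣC-triplesOn≤ΣC-pivotsAt = begin
      ΣC n triplesOn                                ≡⟨ ΣC-ΣL n 𝓕³ tripleOn ⟩
      ΣL 𝓕³ (λ t → ΣC n (λ ch → tripleOn ch t))    ≤⟨ ΣL-mono 𝓕³ per-triple ⟩
      ΣL 𝓕³ (λ t → ΣC n (λ ch → pivotAt ch t)) ≡⟨ ΣC-ΣL n 𝓕³ pivotAt ⟨
      ΣC n pivotsAt                                ∎
      where
      per-triple : ∀ {t} → t ∈ 𝓕³ → ΣC n (λ ch → tripleOn ch t) ≤ ΣC n (λ ch → pivotAt ch t)
      per-triple {a , X , b} t∈ with a ⊂? X | X ⊂? b | ∈𝓕³⁻ t∈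
      ... | no  _   | _       | _           = ≤-refl
      ... | yes _   | no  _   | _           = ≤-refl
      ... | yes a⊂X | yes X⊂b | a∈ , _ , b∈ = begin
        ΣC n (λ ch → 1 * through ch (a ∷ X ∷ b ∷ [])) ≡⟨ ΣC-*ˡ n 1 (λ ch → through ch (a ∷ X ∷ b ∷ [])) ⟩
        1 * ΣC n (λ ch → through ch (a ∷ X ∷ b ∷ [])) ≡⟨ *-identityˡ _ ⟩
        ΣC n (λ ch → through ch (a ∷ X ∷ b ∷ []))     ≤⟨ ΣC-through≤ΣC-pivot a⊂X X⊂b (0<∣F∣ a∈) (∣F∣<n b∈) ⟩
        ΣC n (λ ch → 𝟙 (pivot? ch a X b))             ∎

    record PivotingTriple (ch : Chain n) : Set where
      constructor pivoting
      field
        a X b : Subset n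
        a∈ : a ∈ 𝓕
        X∈ : X ∈ 𝓕
        b∈ : b ∈ 𝓕
        a⊂X : a ⊂ X
        X⊂b : X ⊂ b
        X-on : OnChain ch X
        a-off : ¬ OnChain ch a
        b-off : ¬ OnChain ch b

    pivoting-triple : ∀ {ch} → 0 < pivotsAt ch → PivotingTriple ch
    pivoting-triple {ch} 0<pivots
      with (a , X , b) , t∈ , 0<pivot ← ΣL-pos 𝓕³ 0<pivots
      with a∈ , X∈ , b∈ ← ∈𝓕³⁻ t∈
      with (a⊂X , X⊂b) , X-on , a-off , b-off ← 𝟙-pos (nested? (a , X , b) ×-dec pivot? ch a X b) 0<pivot
      = pivoting a X b a∈ X∈ b∈ a⊂X X⊂b X-on a-off b-off

    module _ {ch : Chain n} (p : PivotingTriple ch) where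

      open PivotingTriple p

      member-of-pivot : ∀ {F} → F ∈ 𝓕 → OnChain ch F → F ≡ X
      member-of-pivot {F} F∈ F-on with <-cmp ∣ F ∣ ∣ X ∣
      ... | tri< ∣F∣<∣X∣ _ _ =
        let F⊂X = onChain-⊂ ch F-on X-on ∣F∣<∣X∣ in
        ⊥-elim (butterfly noButterfly F∈ a∈ X∈ b∈ (λ F≡a → a-off (subst (OnChain ch) F≡a F-on)) (⊂⇒≢ X⊂b)
                  F⊂X (⊂-trans F⊂X X⊂b) a⊂X (⊂-trans a⊂X X⊂b))
      ... | tri≈ _ ∣F∣≡∣X∣ _ = onChain-≡ ch F-on X-on ∣F∣≡∣X∣
      ... | tri> _ _ ∣X∣<∣F∣ =
        let X⊂F = onChain-⊂ ch X-on F-on ∣X∣<∣F∣ in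
        ⊥-elim (butterfly noButterfly a∈ X∈ F∈ b∈ (⊂⇒≢ a⊂X) (λ F≡b → b-off (subst (OnChain ch) F≡b F-on))
                  (⊂-trans a⊂X X⊂F) (⊂-trans a⊂X X⊂b) X⊂F X⊂b)

      pivot-unique : ∀ {t} → t ∈ 𝓕³ → 0 < pivotAt ch t → t ≡ (a , X , b)
      pivot-unique {a′ , X′ , b′} t∈ 0<pivot
        with a′∈ , X′∈ , b′∈ ← ∈𝓕³⁻ t∈
        with (a′⊂X′ , X′⊂b′) , (X′-on , _) ← 𝟙-pos (nested? (a′ , X′ , b′) ×-dec pivot? ch a′ X′ b′) 0<pivot
        with refl ← member-of-pivot X′∈ X′-on
        = cong₂ (λ a″ b″ → a″ , X , b″) a′≡a b′≡b
        where
        a′≡a : a′ ≡ a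
        a′≡a = decidable-stable (a′ ≟ₛ a) λ a′≢a →
          butterfly noButterfly a′∈ a∈ X∈ b∈ a′≢a (⊂⇒≢ X⊂b) a′⊂X′ (⊂-trans a′⊂X′ X⊂b) a⊂X (⊂-trans a⊂X X⊂b)
        b′≡b : b′ ≡ b
        b′≡b = decidable-stable (b′ ≟ₛ b) λ b′≢b →
          butterfly noButterfly a∈ X∈ b′∈ b∈ (⊂⇒≢ a⊂X) b′≢b (⊂-trans a⊂X X′⊂b′) (⊂-trans a⊂X X⊂b) X′⊂b′ X⊂b

      membersOn+pivotsAt≤2 : membersOn ch + pivotsAt ch ≤ 2
      membersOn+pivotsAt≤2 = +-mono-≤
        (ΣL-≤1 𝓕! (λ F → 𝟙≤1 (on? ch F)) λ F∈ 0<on → member-of-pivot F∈ (𝟙-pos (on? ch _) 0<on))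
        (ΣL-≤1 𝓕³! (λ t → 𝟙≤1 (nested? t ×-dec pivot? ch _ _ _)) pivot-unique)

    module _ (ch : Chain n) where

      in𝓕? : ∀ i → Dec (level ch i ∈ 𝓕)
      in𝓕? i = level ch i ∈? 𝓕

      levelsIn𝓕 : List ℕ
      levelsIn𝓕 = filter in𝓕? (downFrom (suc n))

      membersOn≤length-levelsIn𝓕 : membersOn ch ≤ length levelsIn𝓕
      membersOn≤length-levelsIn𝓕 = begin
        ΣL 𝓕 (on ch)
          ≤⟨ ΣL-mono 𝓕 (λ {F} _ → ∈⇒≤ΣL (λ i → 𝟙 (level ch i ≟ₛ F)) (∈-downFrom⁺ (s≤s (∣p∣≤n F)))) ⟩
        ΣL 𝓕 (λ F → ΣL levels (λ i → 𝟙 (level ch i ≟ₛ F)))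
          ≡⟨ ΣL-swap 𝓕 levels _ ⟩
        ΣL levels (λ i → ΣL 𝓕 (λ F → 𝟙 (level ch i ≟ₛ F)))
          ≤⟨ ΣL-mono levels (λ {i} _ → ΣL-𝟙≟≤𝟙∈ _≟ₛ_ 𝓕! (level ch i)) ⟩
        ΣL levels (λ i → 𝟙 (in𝓕? i))
          ≡⟨ ΣL-𝟙 in𝓕? levels ⟩
        length levelsIn𝓕
          ∎
        where levels = downFrom (suc n)

      1≤triplesOn : ∀ {i j k} → k < j → j < i → i ≤ n → level ch k ∈ 𝓕 → level ch j ∈ 𝓕 → level ch i ∈ 𝓕 →
                        1 ≤ triplesOn ch
      1≤triplesOn k<j j<i i≤n k∈ j∈ i∈ = ≤-trans (≤-reflexive (sym on-triple)) (∈⇒≤ΣL (tripleOn ch) (∈𝓕³⁺ k∈ j∈ i∈))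
        where
        j≤n = ≤-trans (<⇒≤ j<i) i≤n
        k≤n = ≤-trans (<⇒≤ k<j) j≤n
        on-triple : tripleOn ch (level ch _ , level ch _ , level ch _) ≡ 1
        on-triple = cong₂ _*_ (𝟙-yes (nested? _) (level-⊂ ch k<j j≤n , level-⊂ ch j<i i≤n))
          (through-onChain ch (level-onChain ch k≤n ∷ level-onChain ch j≤n ∷ level-onChain ch i≤n ∷ []))

      length≤2+triplesOn : ∀ {is} → AllPairs _>_ is → All (λ i → level ch i ∈ 𝓕) is → All (_< suc n) is →
                          length is ≤ 2 + triplesOn ch
      length≤2+triplesOn {[]}        _ _ _ = z≤n
      length≤2+triplesOn {_ ∷ []}    _ _ _ = s≤s z≤n
      length≤2+triplesOn {_ ∷ _ ∷ []} _ _ _ = s≤s (s≤s z≤n)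
      length≤2+triplesOn {_ ∷ _ ∷ _ ∷ []} ((j<i ∷ _) ∷ (k<j ∷ []) ∷ _) (i∈ ∷ j∈ ∷ k∈ ∷ []) (s≤s i≤n ∷ _) =
        s≤s (s≤s (1≤triplesOn k<j j<i i≤n k∈ j∈ i∈))
      length≤2+triplesOn {_ ∷ _ ∷ _ ∷ _ ∷ _} ((j<i ∷ k<i ∷ l<i ∷ _) ∷ (k<j ∷ l<j ∷ _) ∷ (l<k ∷ _) ∷ _)
                        (i∈ ∷ j∈ ∷ k∈ ∷ l∈ ∷ _) (s≤s i≤n ∷ s≤s j≤n ∷ s≤s k≤n ∷ _) =
        ⊥-elim (butterfly noButterfly l∈ k∈ j∈ i∈ (⊂⇒≢ (level-⊂ ch l<k k≤n)) (⊂⇒≢ (level-⊂ ch j<i i≤n))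
                  (level-⊂ ch l<j j≤n) (level-⊂ ch l<i i≤n) (level-⊂ ch k<j j≤n) (level-⊂ ch k<i i≤n))

      membersOn≤2+triplesOn : membersOn ch ≤ 2 + triplesOn ch
      membersOn≤2+triplesOn = ≤-trans membersOn≤length-levelsIn𝓕 (length≤2+triplesOn
        (AllPairs.filter⁺ in𝓕? (downFrom-decreasing (suc n)))
        (All.all-filter in𝓕? (downFrom (suc n)))
        (All.filter⁺ in𝓕? (All.tabulate ∈-downFrom⁻)))

      membersOn+pivotsAt≤2+triplesOn : membersOn ch + pivotsAt ch ≤ 2 + triplesOn ch
      membersOn+pivotsAt≤2+triplesOn with 0 <? pivotsAt ch
      ... | yes 0<pivots = ≤-trans (membersOn+pivotsAt≤2 (pivoting-triple 0<pivots)) (m≤m+n 2 _)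
      ... | no ¬0<pivots = begin
        membersOn ch + pivotsAt ch ≡⟨ cong (membersOn ch +_) (≯0⇒≡0 ¬0<pivots) ⟩
        membersOn ch + 0           ≡⟨ +-identityʳ _ ⟩
        membersOn ch               ≤⟨ membersOn≤2+triplesOn ⟩
        2 + triplesOn ch          ∎

    incidences≤2*n! : ΣL 𝓕 (λ F → ∣ F ∣ ! * (n ∸ ∣ F ∣) !) ≤ 2 * n !
    incidences≤2*n! = +-cancelʳ-≤ (ΣC n pivotsAt) _ _ (begin
      ΣL 𝓕 (λ F → ∣ F ∣ ! * (n ∸ ∣ F ∣) !) + ΣC n pivotsAt ≡⟨ cong (_+ ΣC n pivotsAt) ΣC-membersOn ⟨
      ΣC n membersOn + ΣC n pivotsAt                      ≡⟨ ΣC-+ n membersOn pivotsAt ⟨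
      ΣC n (λ ch → membersOn ch + pivotsAt ch)            ≤⟨ ΣC-mono n membersOn+pivotsAt≤2+triplesOn ⟩
      ΣC n (λ ch → 2 + triplesOn ch)                     ≡⟨ ΣC-+ n (λ _ → 2) triplesOn ⟩
      ΣC n (λ _ → 2) + ΣC n triplesOn                    ≤⟨ +-mono-≤ (≤-reflexive ΣC-2) ΣC-triplesOn≤ΣC-pivotsAt ⟩
      2 * n ! + ΣC n pivotsAt                           ∎)
      where
      ΣC-membersOn : ΣC n membersOn ≡ ΣL 𝓕 (λ F → ∣ F ∣ ! * (n ∸ ∣ F ∣) !)
      ΣC-membersOn = trans (ΣC-ΣL n 𝓕 on) (ΣL-cong 𝓕 λ F → ΣC-on F)
      ΣC-2 : ΣC n (λ _ → 2) ≡ 2 * n !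
      ΣC-2 = trans (ΣC-*ˡ n 2 (λ _ → 1)) (cong (2 *_) (ΣC-1 n))

  -- Lubell sums as rationals

  recipℕ≃ : ∀ {c w d} → c * w ≡ suc d → ℚ.toℚᵘ (recipℕ c) ℚᵘ.≃ ℚᵘ.mkℚᵘ (ℤ.+ w) d
  recipℕ≃ {suc c} {w} c*w≡ =
    ℚᵘ.≃-trans (ℚᵘ.≃-reflexive (cong ℚ.toℚᵘ (ℚ.normalize-coprime (1-coprimeTo (suc c)))))
      (ℚᵘ.*≡* (trans (ℤ.*-identityˡ _) (trans (cong ℤ.+_ (trans (sym c*w≡) (*-comm (suc c) w))) (ℤ.pos-* w (suc c)))))

  mkℚᵘ-+ : ∀ a b d → ℚᵘ.mkℚᵘ (ℤ.+ a) d ℚᵘ.+ ℚᵘ.mkℚᵘ (ℤ.+ b) d ℚᵘ.≃ ℚᵘ.mkℚᵘ (ℤ.+ (a + b)) d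
  mkℚᵘ-+ a b d = ℚᵘ.*≡* (begin
    (ℤ.+ a ℤ.* D ℤ.+ ℤ.+ b ℤ.* D) ℤ.* D ≡⟨ cong (ℤ._* D) (ℤ.*-distribʳ-+ D (ℤ.+ a) (ℤ.+ b)) ⟨
    (ℤ.+ a ℤ.+ ℤ.+ b) ℤ.* D ℤ.* D       ≡⟨ ℤ.*-assoc (ℤ.+ a ℤ.+ ℤ.+ b) D D ⟩
    (ℤ.+ a ℤ.+ ℤ.+ b) ℤ.* (D ℤ.* D)     ≡⟨ cong₂ ℤ._*_ (ℤ.pos-+ a b) (ℤ.pos-* (suc d) (suc d)) ⟨
    ℤ.+ (a + b) ℤ.* ℤ.+ (suc d * suc d) ∎)
    where
    open ≡-Reasoning
    D = ℤ.+ suc d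

  lubell≃ : ∀ {n d} (w : Subset n → ℕ) → (∀ F → (n C ∣ F ∣) * w F ≡ suc d) → ∀ 𝓕 →
            ℚ.toℚᵘ (lubell n 𝓕) ℚᵘ.≃ ℚᵘ.mkℚᵘ (ℤ.+ ΣL 𝓕 w) d
  lubell≃ w C*w≡ []      = ℚᵘ.*≡* refl
  lubell≃ {n} {d} w C*w≡ (F ∷ 𝓕) =
    ℚᵘ.≃-trans (ℚ.toℚᵘ-homo-+ (recipℕ (n C ∣ F ∣)) (lubell n 𝓕))
      (ℚᵘ.≃-trans (ℚᵘ.+-cong (recipℕ≃ {n C ∣ F ∣} {w F} (C*w≡ F)) (lubell≃ w C*w≡ 𝓕)) (mkℚᵘ-+ (w F) (ΣL 𝓕 w) d))

  lubell≤2 : ∀ {n} {𝓕 : List (Subset n)} → Unique 𝓕 → NoButterfly 𝓕 → ∅ ∉ 𝓕 → full ∉ 𝓕 →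
             lubell n 𝓕 ℚ.≤ ℚ.1ℚ ℚ.+ ℚ.1ℚ
  lubell≤2 {n} {𝓕} 𝓕! noButterfly ∅∉𝓕 full∉𝓕 =
    ℚ.toℚᵘ-cancel-≤ (ℚᵘ.≤-respˡ-≃ (ℚᵘ.≃-sym (lubell≃ w C*w≡n! 𝓕)) (ℚᵘ.*≤* (begin
      ℤ.+ ΣL 𝓕 w ℤ.* ℤ.+ 1  ≡⟨ ℤ.*-identityʳ _ ⟩
      ℤ.+ ΣL 𝓕 w            ≤⟨ ℤ.+≤+ (Counting.incidences≤2*n! 𝓕! noButterfly ∅∉𝓕 full∉𝓕) ⟩
      ℤ.+ (2 * n !)         ≡⟨ cong (λ m → ℤ.+ (2 * m)) n!≡ ⟨
      ℤ.+ 2 ℤ.* ℤ.+ suc d   ∎)))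
    where
    open ℤ.≤-Reasoning
    d = pred (n !)
    n!≡ : suc d ≡ n !
    n!≡ = suc-pred (n !) {{n !≢0}}
    w : Subset n → ℕ
    w F = ∣ F ∣ ! * (n ∸ ∣ F ∣) !
    C*w≡n! : ∀ F → (n C ∣ F ∣) * w F ≡ suc d
    C*w≡n! F = trans (nCk*k![n∸k]!≡n! (∣p∣≤n F)) (sym n!≡)

open import Data.Nat using (ℕ; _≥_)
open import Data.Rational using (_≤_; 1ℚ; _+_)
open import Data.List using (List)
open import Data.List.Relation.Unary.Unique.Propositional using (Unique)
open import Data.List.Membership.Propositional using (_∉_)
open import Data.Fin.Subset using (Subset) renaming (⊥ to ∅; ⊤ to full)

-- The bound holds for every n.
theorem2 : (n : ℕ) → n ≥ 3 → (𝓕 : List (Subset n)) → Unique 𝓕 →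
    NoButterfly 𝓕 → ∅ ∉ 𝓕 → full ∉ 𝓕 → lubell n 𝓕 ≤ 1ℚ + 1ℚ
theorem2 _ _ _ = lubell≤2
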